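{- In the graceful game on a wheel $W_n$, $n\geq 3$, if Bob is the first player then Bob has a winning strategy.
   Context: The wheel $W_n$ ($n\geq 3$) is obtained from the cycle $(v_0,\dots,v_{n-1})$ by adding a central vertex $v_n$ adjacent to all $v_0,\dots,v_{n-1}$; it has $n+1$ vertices and $2n$ edges. A graceful labeling of a graph $G$ with $m$ edges is an injective map $f\colon V(G)\to\{0,1,\dots,m\}$ such that the induced edge labels $|f(u)-f(v)|$, $uv\in E(G)$, are pairwise distinct. The graceful game on a simple graph $G$ with $m$ edges: two players, Alice and Bob, alternately choose a free (not yet labeled) vertex and assign to it a label from $\{0,1,\dots,m\}$ not yet used. An edge both of whose endpoints are labeled gets label $|f(u)-f(v)|$; a move is legal only if after it all edge labels are pairwise distinct. Alice wins if the whole graph ends up gracefully labeled; Bob wins if he can prevent this. -}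

module Defs where

open import Data.Nat using (ℕ; zero; suc; _+_; _≤_; _<_; _<?_; ∣_-_∣)
open import Data.Fin using (Fin; zero; suc; toℕ; fromℕ<; inject₁; fromℕ; splitAt)
import Data.Fin as F
open import Data.Maybe using (Maybe; just; nothing)
open import Data.Product using (_×_; _,_; ∃)
open import Data.Sum using (_⊎_; inj₁; inj₂)
open import Relation.Nullary using (¬_; yes; no)
open import Relation.Binary.PropositionalEquality using (_≡_; _≢_)

record Graph : Set where
  field
    nv    : ℕ
    ne    : ℕ
    ends  : Fin ne → Fin nv × Fin nv
open Graph public

next : ∀ {n} → Fin n → Fin n
next {suc k} i with suc (toℕ i) <? suc k
... | yes p = fromℕ< p
... | no _  = zero

-- Wheel W_n: vertices v_0..v_{n-1} (= inject₁ i) and centre v_n (= fromℕ n);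
-- edges 0..n-1 are the cycle edges v_i v_{i+1 mod n}, edges n..2n-1 the spokes v_i v_n.
wheelEnds : ∀ n → Fin (n + n) → Fin (suc n) × Fin (suc n)
wheelEnds n e with splitAt n e
... | inj₁ i = inject₁ i , inject₁ (next i)
... | inj₂ i = inject₁ i , fromℕ n

Wheel : ℕ → Graph
Wheel n = record { nv = suc n ; ne = n + n ; ends = wheelEnds n }

-- Partial vertex labelings (nothing = free vertex).
Lab : Graph → Set
Lab G = Fin (nv G) → Maybe ℕ

empty : (G : Graph) → Lab G
empty G _ = nothing

update : {G : Graph} → Lab G → Fin (nv G) → ℕ → Lab G
update f v l u with u F.≟ v
... | yes _ = just l
... | no _  = f u

labDiff : Maybe ℕ → Maybe ℕ → Maybe ℕ
labDiff (just a) (just b) = just ∣ a - b ∣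
labDiff _        _        = nothing

edgeLabel : {G : Graph} → Lab G → Fin (ne G) → Maybe ℕ
edgeLabel {G} f e with ends G e
... | (u , w) = labDiff (f u) (f w)

DistinctEdgeLabels : {G : Graph} → Lab G → Set
DistinctEdgeLabels {G} f = ∀ (e e' : Fin (ne G)) (k : ℕ) →
  edgeLabel {G} f e ≡ just k → edgeLabel {G} f e' ≡ just k → e ≡ e'

Legal : {G : Graph} → Lab G → Fin (nv G) → ℕ → Set
Legal {G} f v l =
  (f v ≡ nothing) × (l ≤ ne G) × (∀ u → f u ≢ just l) ×
  DistinctEdgeLabels {G} (update {G} f v l)

Complete : {G : Graph} → Lab G → Set
Complete {G} f = ∀ (v : Fin (nv G)) → ∃ λ l → f v ≡ just l

-- Bob has a winning strategy from position f, with Bob (resp. Alice) to move.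
-- Bob wins iff the game ends (no legal move) with some vertex unlabeled.
data BobWinsBobToMove (G : Graph) (f : Lab G) : Set
data BobWinsAliceToMove (G : Graph) (f : Lab G) : Set

data BobWinsBobToMove G f where
  stuck : ¬ Complete {G} f → (∀ v l → ¬ Legal {G} f v l) → BobWinsBobToMove G f
  move  : ∀ v l → Legal {G} f v l →
          BobWinsAliceToMove G (update {G} f v l) → BobWinsBobToMove G f

data BobWinsAliceToMove G f where
  respond : ¬ Complete {G} f →
            (∀ v l → Legal {G} f v l → BobWinsBobToMove G (update {G} f v l)) →
            BobWinsAliceToMove G f

module Submission where

-- Strategy: Bob labels the centre with N, the midpoint of {0,…,2N}.  From then on
-- the labelling can never be completed gracefully: in a graceful labelling of W_N
-- the 2N edge labels are exactly 1,…,2N (pigeonhole), so some edge gets label 2N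
-- and its ends carry 0 and 2N.  It is not a spoke (the centre carries N), and if
-- it is a rim edge v_i v_{i+1} then both spokes v_i c and v_{i+1} c get label N.
-- Since the game is finite, Bob then wins just by playing any legal move.

open import Defs
open import Data.Nat
  using (ℕ; zero; suc; pred; _+_; _≤_; _<_; _>_; z≤n; s≤s; ∣_-_∣; >-nonZero)
import Data.Nat as ℕ
import Data.Nat.Properties as ℕₚ
open import Data.Fin using (Fin; toℕ; fromℕ; fromℕ<; inject₁; splitAt; _↑ˡ_; _↑ʳ_)
import Data.Fin as Fin
import Data.Fin.Properties as Finₚ
open import Data.Maybe using (Maybe; just; nothing)
import Data.Maybe.Properties as Maybeₚ
open import Data.Product using (_×_; _,_; proj₁; proj₂; ∃; ∃₂)
open import Data.Sum using (_⊎_; inj₁; inj₂)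
open import Data.Empty using (⊥; ⊥-elim)
open import Function.Definitions using (Injective)
open import Relation.Nullary using (¬_; Dec; yes; no)
open import Relation.Nullary.Decidable using (_×-dec_; ¬?)
open import Relation.Binary.PropositionalEquality
  using (_≡_; _≢_; refl; sym; trans; cong; cong₂; subst; module ≡-Reasoning)

update-same : {G : Graph} (f : Lab G) (v : Fin (nv G)) (l : ℕ) → update {G} f v l v ≡ just l
update-same f v l with v Fin.≟ v
... | yes _  = refl
... | no v≢v = ⊥-elim (v≢v refl)

update-other : {G : Graph} (f : Lab G) (v : Fin (nv G)) (l : ℕ) (u : Fin (nv G)) →
               u ≢ v → update {G} f v l u ≡ f u
update-other f v l u u≢v with u Fin.≟ v
... | yes u≡v = ⊥-elim (u≢v u≡v)
... | no _    = refl

update-label : {G : Graph} (f : Lab G) (v : Fin (nv G)) (l : ℕ) (u : Fin (nv G)) (k : ℕ) →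
               update {G} f v l u ≡ just k → (u ≡ v × l ≡ k) ⊎ f u ≡ just k
update-label f v l u k fu≡k with u Fin.≟ v
... | yes u≡v = inj₁ (u≡v , Maybeₚ.just-injective fu≡k)
... | no _    = inj₂ fu≡k

labDiff-just : ∀ {x y : Maybe ℕ} {k : ℕ} → labDiff x y ≡ just k →
               ∃₂ λ a b → x ≡ just a × y ≡ just b
labDiff-just {just a} {just b} _ = a , b , refl , refl

-- Number of free (unlabelled) positions of a partial labelling; it bounds the
-- length of the remaining game.
isFree : Maybe ℕ → ℕ
isFree nothing  = 1
isFree (just _) = 0

freeCount : ∀ {k} → (Fin k → Maybe ℕ) → ℕ
freeCount {zero}  f = 0
freeCount {suc k} f = isFree (f Fin.zero) + freeCount (λ i → f (Fin.suc i))

freeCount-cong : ∀ {k} (h g : Fin k → Maybe ℕ) → (∀ u → h u ≡ g u) → freeCount h ≡ freeCount g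
freeCount-cong {zero}  h g h≗g = refl
freeCount-cong {suc k} h g h≗g rewrite h≗g Fin.zero =
  cong (isFree (g Fin.zero) +_) (freeCount-cong _ _ λ u → h≗g (Fin.suc u))

freeCount-< : ∀ {k} (g h : Fin k → Maybe ℕ) (v : Fin k) (l : ℕ) →
              g v ≡ nothing → h v ≡ just l → (∀ u → u ≢ v → h u ≡ g u) →
              freeCount h < freeCount g
freeCount-< g h Fin.zero l gv hv same
  rewrite gv | hv
        | freeCount-cong (λ i → h (Fin.suc i)) (λ i → g (Fin.suc i)) (λ u → same (Fin.suc u) λ ())
        = ℕₚ.≤-refl
freeCount-< g h (Fin.suc v) l gv hv same rewrite same Fin.zero (λ ()) =
  ℕₚ.+-monoʳ-< (isFree (g Fin.zero))
    (freeCount-< (λ i → g (Fin.suc i)) (λ i → h (Fin.suc i)) v l gv hv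
       λ u u≢v → same (Fin.suc u) (λ eq → u≢v (Finₚ.suc-injective eq)))

legal⇒freeCount-< : {G : Graph} (f : Lab G) (v : Fin (nv G)) (l : ℕ) →
                    Legal {G} f v l → freeCount (update {G} f v l) < freeCount f
legal⇒freeCount-< {G} f v l (fv≡nothing , _) =
  freeCount-< f (update {G} f v l) v l fv≡nothing (update-same {G} f v l) (update-other {G} f v l)

-- Deciding legality (Bob needs to know whether a legal move exists)

sameLabel⇒? : ∀ {P : Set} (x y : Maybe ℕ) → Dec P → Dec (∀ k → x ≡ just k → y ≡ just k → P)
sameLabel⇒? x        y        (yes p) = yes λ _ _ _ → p
sameLabel⇒? nothing  y        (no _)  = yes λ _ ()
sameLabel⇒? (just a) nothing  (no _)  = yes λ _ _ ()
sameLabel⇒? (just a) (just b) (no ¬p) with a ℕ.≟ b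
... | yes refl = no λ same⇒p → ¬p (same⇒p a refl refl)
... | no a≢b   = yes λ { k refl refl → ⊥-elim (a≢b refl) }

distinctEdgeLabels? : {G : Graph} (f : Lab G) → Dec (DistinctEdgeLabels {G} f)
distinctEdgeLabels? {G} f = Finₚ.all? λ e → Finₚ.all? λ e' →
  sameLabel⇒? (edgeLabel {G} f e) (edgeLabel {G} f e') (e Fin.≟ e')

legal? : {G : Graph} (f : Lab G) (v : Fin (nv G)) (l : ℕ) → Dec (Legal {G} f v l)
legal? {G} f v l =
  Maybeₚ.≡-dec ℕ._≟_ (f v) nothing ×-dec l ℕ.≤? ne G ×-dec
  Finₚ.all? (λ u → ¬? (Maybeₚ.≡-dec ℕ._≟_ (f u) (just l))) ×-dec
  distinctEdgeLabels? {G} (update {G} f v l)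

legalMove? : {G : Graph} (f : Lab G) →
             (∃₂ λ v l → Legal {G} f v l) ⊎ (∀ v l → ¬ Legal {G} f v l)
legalMove? {G} f
  with Finₚ.any? (λ v → Finₚ.any? (λ (l : Fin (suc (ne G))) → legal? {G} f v (toℕ l)))
... | yes (v , l , legal) = inj₁ (v , toℕ l , legal)
... | no none = inj₂ λ v l legal →
  let l<1+m = s≤s (proj₁ (proj₂ legal)) in
  none (v , fromℕ< l<1+m , subst (Legal {G} f v) (sym (Finₚ.toℕ-fromℕ< l<1+m)) legal)

record PartiallyGraceful {G : Graph} (f : Lab G) : Set where
  field
    bounded  : ∀ v l → f v ≡ just l → l ≤ ne G
    unique   : ∀ u w l → f u ≡ just l → f w ≡ just l → u ≡ w
    distinct : DistinctEdgeLabels {G} f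

legal-preserves : {G : Graph} (f : Lab G) (v : Fin (nv G)) (l : ℕ) →
                  PartiallyGraceful {G} f → Legal {G} f v l →
                  PartiallyGraceful {G} (update {G} f v l)
legal-preserves {G} f v l pg (_ , l≤m , l-unused , distinct′) = record
  { bounded = bounded′ ; unique = unique′ ; distinct = distinct′ }
  where
  open PartiallyGraceful pg
  bounded′ : ∀ u k → update {G} f v l u ≡ just k → k ≤ ne G
  bounded′ u k fu≡k with update-label {G} f v l u k fu≡k
  ... | inj₁ (_ , refl) = l≤m
  ... | inj₂ old        = bounded u k old
  unique′ : ∀ u w k → update {G} f v l u ≡ just k → update {G} f v l w ≡ just k → u ≡ w
  unique′ u w k fu≡k fw≡k with update-label {G} f v l u k fu≡k | update-label {G} f v l w k fw≡k
  ... | inj₁ (u≡v , _)  | inj₁ (w≡v , _)  = trans u≡v (sym w≡v)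
  ... | inj₁ (_ , refl) | inj₂ old        = ⊥-elim (l-unused w old)
  ... | inj₂ old        | inj₁ (_ , refl) = ⊥-elim (l-unused u old)
  ... | inj₂ old        | inj₂ old′       = unique u w k old old′

legal-keeps-label : {G : Graph} (f : Lab G) (v : Fin (nv G)) (l : ℕ) → Legal {G} f v l →
                    ∀ u k → f u ≡ just k → update {G} f v l u ≡ just k
legal-keeps-label {G} f v l (fv≡nothing , _) u k fu≡k = trans (update-other {G} f v l u u≢v) fu≡k
  where
  u≢v : u ≢ v
  u≢v refl with trans (sym fu≡k) fv≡nothing
  ... | ()

Loopless : Graph → Set
Loopless G = ∀ e → proj₁ (ends G e) ≢ proj₂ (ends G e)

first-move-legal : {G : Graph} → Loopless G → (v : Fin (nv G)) (l : ℕ) → l ≤ ne G →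
                   Legal {G} (empty G) v l
first-move-legal {G} loopless v l l≤m = refl , l≤m , (λ u ()) , noEdgeLabelled
  where
  onlyAtV : ∀ u k → update {G} (empty G) v l u ≡ just k → u ≡ v
  onlyAtV u k fu≡k with update-label {G} (empty G) v l u k fu≡k
  ... | inj₁ (u≡v , _) = u≡v
  noEdgeLabelled : DistinctEdgeLabels {G} (update {G} (empty G) v l)
  noEdgeLabelled e e' k e↦k _ with labDiff-just e↦k
  ... | a , b , fa , fb = ⊥-elim (loopless e (trans (onlyAtV _ a fa) (sym (onlyAtV _ b fb))))

empty-partiallyGraceful : (G : Graph) → PartiallyGraceful {G} (empty G)
empty-partiallyGraceful G = record { bounded = λ _ _ () ; unique = λ _ _ _ () ; distinct = λ _ _ _ () }

-- Bob wins once Alice can no longer win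

-- From a spoilt position Bob wins whoever is to move: the game
-- is finite, no terminal position is complete, and legal moves stay spoilt.
module BobWinsSpoiltPositions
  (G : Graph) (Spoilt : Lab G → Set)
  (spoilt-preserved : ∀ f v l → Spoilt f → Legal {G} f v l → Spoilt (update {G} f v l))
  (spoilt-incomplete : ∀ f → Spoilt f → ¬ Complete {G} f)
  where

  bobWins : ∀ k f → freeCount f ≤ k → Spoilt f →
            BobWinsBobToMove G f × BobWinsAliceToMove G f
  bobWins zero f full spoilt =
    stuck (spoilt-incomplete f spoilt) noMove ,
    respond (spoilt-incomplete f spoilt) λ v l legal → ⊥-elim (noMove v l legal)
    where
    noMove : ∀ v l → ¬ Legal {G} f v l
    noMove v l legal with ℕₚ.<-≤-trans (legal⇒freeCount-< {G} f v l legal) full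
    ... | ()
  bobWins (suc k) f free≤1+k spoilt =
    bobMoves , respond (spoilt-incomplete f spoilt) λ v l legal → proj₁ (afterMove v l legal)
    where
    afterMove : ∀ v l → Legal {G} f v l →
                BobWinsBobToMove G (update {G} f v l) × BobWinsAliceToMove G (update {G} f v l)
    afterMove v l legal = bobWins k _
      (ℕₚ.≤-pred (ℕₚ.<-≤-trans (legal⇒freeCount-< {G} f v l legal) free≤1+k))
      (spoilt-preserved f v l spoilt legal)
    bobMoves : BobWinsBobToMove G f
    bobMoves with legalMove? {G} f
    ... | inj₁ (v , l , legal) = move v l legal (proj₂ (afterMove v l legal))
    ... | inj₂ none            = stuck (spoilt-incomplete f spoilt) none

  bobWinsAliceToMove : ∀ f → Spoilt f → BobWinsAliceToMove G f
  bobWinsAliceToMove f spoilt = proj₂ (bobWins (freeCount f) f ℕₚ.≤-refl spoilt)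

∣-∣-bounded : ∀ {x y M} → x ≤ M → y ≤ M → ∣ x - y ∣ ≤ M
∣-∣-bounded {x} {y} x≤M y≤M = ℕₚ.≤-trans (ℕₚ.∣m-n∣≤m⊔n x y) (ℕₚ.⊔-lub x≤M y≤M)

∣-∣-extreme : ∀ x y M → x ≤ M → y ≤ M → ∣ x - y ∣ ≡ M → (x ≡ 0 × y ≡ M) ⊎ (x ≡ M × y ≡ 0)
∣-∣-extreme zero    y       M       _         _         d≡M = inj₁ (refl , d≡M)
∣-∣-extreme (suc x) zero    M       _         _         d≡M = inj₂ (d≡M , refl)
∣-∣-extreme (suc x) (suc y) (suc M) (s≤s x≤M) (s≤s y≤M) d≡M =
  ⊥-elim (ℕₚ.1+n≰n (subst (_≤ M) d≡M (∣-∣-bounded x≤M y≤M)))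

edgeDiff : (G : Graph) → (Fin (nv G) → ℕ) → Fin (ne G) → ℕ
edgeDiff G lab e = ∣ lab (proj₁ (ends G e)) - lab (proj₂ (ends G e)) ∣

edgeDiff-ends : ∀ (G : Graph) (lab : Fin (nv G) → ℕ) e {u w} → ends G e ≡ (u , w) →
                edgeDiff G lab e ≡ ∣ lab u - lab w ∣
edgeDiff-ends G lab e ends≡ = cong (λ p → ∣ lab (proj₁ p) - lab (proj₂ p) ∣) ends≡

record IsGraceful (G : Graph) (lab : Fin (nv G) → ℕ) : Set where
  field
    bounded       : ∀ v → lab v ≤ ne G
    injective     : Injective _≡_ _≡_ lab
    edgeInjective : Injective _≡_ _≡_ (edgeDiff G lab)

labelOf : {G : Graph} {f : Lab G} → Complete {G} f → Fin (nv G) → ℕ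
labelOf complete v = proj₁ (complete v)

complete⇒graceful : {G : Graph} (f : Lab G) → PartiallyGraceful {G} f →
                    (complete : Complete {G} f) → IsGraceful G (labelOf {G} complete)
complete⇒graceful {G} f pg complete = record
  { bounded       = λ v → bounded v _ (proj₂ (complete v))
  ; injective     = λ {u} {w} eq →
      unique u w _ (proj₂ (complete u)) (trans (proj₂ (complete w)) (cong just (sym eq)))
  ; edgeInjective = λ {e} {e'} eq →
      distinct e e' _ (edgeLabel≡ e) (trans (edgeLabel≡ e') (cong just (sym eq)))
  }
  where
  open PartiallyGraceful pg
  edgeLabel≡ : ∀ e → edgeLabel {G} f e ≡ just (edgeDiff G (labelOf {G} complete) e)
  edgeLabel≡ e = cong₂ labDiff (proj₂ (complete (proj₁ (ends G e))))
                               (proj₂ (complete (proj₂ (ends G e))))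

-- The edge labels of a graceful labelling of a loopless graph lie in {1,…,m},
-- pairwise distinct; by pigeonhole the largest one, m, is attained (for m ≥ 1).
graceful⇒topEdge : {G : Graph} {lab : Fin (nv G) → ℕ} → Loopless G → 0 < ne G →
                   IsGraceful G lab → ∃ λ e → edgeDiff G lab e ≡ ne G
graceful⇒topEdge {G} {lab} loopless m>0 graceful
  with Finₚ.any? (λ e → edgeDiff G lab e ℕ.≟ ne G)
... | yes top = top
... | no noTop = ⊥-elim (Finₚ.<⇒notInjective pred[m]<m shrink-injective)
  where
  open IsGraceful graceful
  d : Fin (ne G) → ℕ
  d = edgeDiff G lab
  -- Edge labels are positive (no loops, distinct vertex labels) and, lacking an
  -- edge labelled m, below m; so e ↦ d e - 1 injects the m edges into m - 1 values.
  d>0 : ∀ e → d e > 0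
  d>0 e = ℕₚ.n≢0⇒n>0 λ d≡0 →
    loopless e (injective (ℕₚ.∣m-n∣≡0⇒m≡n d≡0))
  d<m : ∀ e → d e < ne G
  d<m e = ℕₚ.≤∧≢⇒< (∣-∣-bounded (bounded _) (bounded _)) λ d≡m → noTop (e , d≡m)
  shrink : Fin (ne G) → Fin (pred (ne G))
  shrink e = fromℕ< (ℕₚ.pred-mono-< {{>-nonZero (d>0 e)}} (d<m e))
  shrink-injective : Injective _≡_ _≡_ shrink
  shrink-injective {e} {e'} eq = edgeInjective
    (ℕₚ.pred-injective {{>-nonZero (d>0 e)}} {{>-nonZero (d>0 e')}}
      (Finₚ.fromℕ<-injective _ _ _ _ eq))
  pred[m]<m : pred (ne G) < ne G
  pred[m]<m = subst (pred (ne G) <_) (ℕₚ.suc-pred (ne G) {{>-nonZero m>0}}) (ℕₚ.n<1+n _)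

-- The wheel W_N

wheelEdge : ∀ N (e : Fin (N + N)) → (∃ λ i → i ↑ˡ N ≡ e) ⊎ (∃ λ i → N ↑ʳ i ≡ e)
wheelEdge N e with splitAt N e in split
... | inj₁ i = inj₁ (i , Finₚ.splitAt⁻¹-↑ˡ split)
... | inj₂ i = inj₂ (i , Finₚ.splitAt⁻¹-↑ʳ split)

rimEnds : ∀ N (i : Fin N) → ends (Wheel N) (i ↑ˡ N) ≡ (inject₁ i , inject₁ (next i))
rimEnds N i rewrite Finₚ.splitAt-↑ˡ N i N = refl

spokeEnds : ∀ N (i : Fin N) → ends (Wheel N) (N ↑ʳ i) ≡ (inject₁ i , fromℕ N)
spokeEnds N i rewrite Finₚ.splitAt-↑ʳ N N i = refl

∣extreme-N∣ : ∀ {x} N → x ≡ 0 ⊎ x ≡ N + N → ∣ x - N ∣ ≡ N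
∣extreme-N∣ N (inj₁ refl) = refl
∣extreme-N∣ N (inj₂ refl) = trans (ℕₚ.m≤n⇒∣n-m∣≡n∸m (ℕₚ.m≤n+m N N)) (ℕₚ.m+n∸n≡m N N)

module WheelAtLeast2 (k : ℕ) where

  N : ℕ
  N = suc (suc k)

  centre : Fin (suc N)
  centre = fromℕ N

  next-≢ : (i : Fin N) → next i ≢ i
  next-≢ i with suc (toℕ i) ℕ.<? N
  ... | yes i+1<N = λ eq → ℕₚ.1+n≢n (trans (sym (Finₚ.toℕ-fromℕ< i+1<N)) (cong toℕ eq))
  ... | no  i+1≮N = λ 0≡i → i+1≮N (subst (λ j → suc (toℕ j) < N) 0≡i (s≤s (s≤s z≤n)))

  loopless : Loopless (Wheel N)
  loopless e with wheelEdge N e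
  ... | inj₁ (i , refl) rewrite rimEnds N i =
    λ vᵢ≡vᵢ₊₁ → next-≢ i (sym (Finₚ.inject₁-injective vᵢ≡vᵢ₊₁))
  ... | inj₂ (i , refl) rewrite spokeEnds N i = λ vᵢ≡c → Finₚ.fromℕ≢inject₁ (sym vᵢ≡c)

  module GracefulWithCentreN (lab : Fin (suc N) → ℕ) (graceful : IsGraceful (Wheel N) lab)
                         (centre≡N : lab centre ≡ N) where
    open IsGraceful graceful

    spoke≡N : ∀ j → lab (inject₁ j) ≡ 0 ⊎ lab (inject₁ j) ≡ N + N →
              edgeDiff (Wheel N) lab (N ↑ʳ j) ≡ N
    spoke≡N j extreme = begin
      edgeDiff (Wheel N) lab (N ↑ʳ j)  ≡⟨ edgeDiff-ends (Wheel N) lab (N ↑ʳ j) (spokeEnds N j) ⟩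
      ∣ lab (inject₁ j) - lab centre ∣ ≡⟨ cong (λ c → ∣ lab (inject₁ j) - c ∣) centre≡N ⟩
      ∣ lab (inject₁ j) - N ∣          ≡⟨ ∣extreme-N∣ N extreme ⟩
      N                                ∎
      where open ≡-Reasoning

    -- No spoke has label 2N: its centre end carries N, neither 0 nor 2N.
    spoke≢2N : ∀ i → edgeDiff (Wheel N) lab (N ↑ʳ i) ≢ N + N
    spoke≢2N i top
      with ∣-∣-extreme _ _ (N + N) (bounded _) (bounded _)
             (trans (sym (edgeDiff-ends (Wheel N) lab (N ↑ʳ i) (spokeEnds N i))) top)
    ... | inj₁ (_ , c≡2N) = ℕₚ.m+1+n≢m N (trans (sym c≡2N) centre≡N)
    ... | inj₂ (_ , c≡0)  = ℕₚ.0≢1+n (trans (sym c≡0) centre≡N)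

    -- The ends of a rim edge v_i v_{i+1} are not both labelled 0 or 2N: otherwise
    -- the spokes at v_i and v_{i+1} would share the label N.
    rimEnds-not-extreme : ∀ i → lab (inject₁ i) ≡ 0 ⊎ lab (inject₁ i) ≡ N + N →
                          lab (inject₁ (next i)) ≡ 0 ⊎ lab (inject₁ (next i)) ≡ N + N → ⊥
    rimEnds-not-extreme i vᵢ-extreme vᵢ₊₁-extreme = next-≢ i (sym (Finₚ.↑ʳ-injective N i (next i)
      (edgeInjective (trans (spoke≡N i vᵢ-extreme) (sym (spoke≡N (next i) vᵢ₊₁-extreme))))))

    -- Hence no rim edge has label 2N, as its ends would carry 0 and 2N.
    rim≢2N : ∀ i → edgeDiff (Wheel N) lab (i ↑ˡ N) ≢ N + N
    rim≢2N i top
      with ∣-∣-extreme _ _ (N + N) (bounded _) (bounded _)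
             (trans (sym (edgeDiff-ends (Wheel N) lab (i ↑ˡ N) (rimEnds N i))) top)
    ... | inj₁ (vᵢ≡0 , vᵢ₊₁≡2N) = rimEnds-not-extreme i (inj₁ vᵢ≡0) (inj₂ vᵢ₊₁≡2N)
    ... | inj₂ (vᵢ≡2N , vᵢ₊₁≡0) = rimEnds-not-extreme i (inj₂ vᵢ≡2N) (inj₁ vᵢ₊₁≡0)

  -- No graceful labelling of W_N gives the centre the label N, since some edge is
  -- labelled 2N.
  centre≢N : (lab : Fin (suc N) → ℕ) → IsGraceful (Wheel N) lab → lab centre ≢ N
  centre≢N lab graceful centre≡N with graceful⇒topEdge loopless (s≤s z≤n) graceful
  ... | e , top with wheelEdge N e
  ... | inj₁ (i , refl) = GracefulWithCentreN.rim≢2N   lab graceful centre≡N i top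
  ... | inj₂ (i , refl) = GracefulWithCentreN.spoke≢2N lab graceful centre≡N i top

  CentreLabelledN : Lab (Wheel N) → Set
  CentreLabelledN f = PartiallyGraceful {Wheel N} f × f centre ≡ just N

  centreLabelledN-preserved : ∀ f v l → CentreLabelledN f → Legal {Wheel N} f v l →
                              CentreLabelledN (update {Wheel N} f v l)
  centreLabelledN-preserved f v l (pg , centre↦N) legal =
    legal-preserves {Wheel N} f v l pg legal , legal-keeps-label {Wheel N} f v l legal centre N centre↦N

  centreLabelledN-incomplete : ∀ f → CentreLabelledN f → ¬ Complete {Wheel N} f
  centreLabelledN-incomplete f (pg , centre↦N) complete =
    centre≢N (labelOf {Wheel N} complete) (complete⇒graceful {Wheel N} f pg complete)
      (Maybeₚ.just-injective (trans (sym (proj₂ (complete centre))) centre↦N))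

theorem6 : ∀ (n : ℕ) → 3 ≤ n → BobWinsBobToMove (Wheel n) (empty (Wheel n))
theorem6 (suc (suc (suc k))) (s≤s (s≤s (s≤s _))) =
  move centre N firstMove (bobWinsAliceToMove afterFirstMove afterFirstMove-spoilt)
  where
  open WheelAtLeast2 (suc k)
  open BobWinsSpoiltPositions (Wheel N) CentreLabelledN
         centreLabelledN-preserved centreLabelledN-incomplete
  firstMove : Legal {Wheel N} (empty (Wheel N)) centre N
  firstMove = first-move-legal loopless centre N (ℕₚ.m≤m+n N N)
  afterFirstMove : Lab (Wheel N)
  afterFirstMove = update {Wheel N} (empty (Wheel N)) centre N
  afterFirstMove-spoilt : CentreLabelledN afterFirstMove
  afterFirstMove-spoilt =
    legal-preserves {Wheel N} (empty (Wheel N)) centre N (empty-partiallyGraceful (Wheel N)) firstMove ,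
    update-same {Wheel N} (empty (Wheel N)) centre N
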